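{- Let $\alpha=(\alpha_1,\dots,\alpha_n)$ be a composition and suppose $1\le r\le n-1$ satisfies $\alpha_r<\alpha_{r+1}$. Let $\alpha'=\alpha\cdot s_r$. Then \[V(\alpha)=V(\alpha')\cup\{v\cdot s_r\colon v\in V(\alpha')\},\] where $V(\gamma)=\{\beta\colon\beta\le\gamma\}$.
   Context: A composition is a vector of nonnegative integers. $s_r$ is the adjacent transposition $(r,r+1)$ in $S_n$. For $w=w_1\cdots w_n\in S_n$ and $v\in\mathbb{R}^n$, $v\cdot w=(v_{w_1},\dots,v_{w_n})$ (so $v\cdot s_r$ swaps the $r$-th and $(r+1)$-th coordinates). $\lambda(\gamma)$ is the partition obtained by sorting the parts of $\gamma$ decreasingly, and $w(\gamma)$ is the unique permutation of minimal length with $\lambda(\gamma)\cdot w(\gamma)=\gamma$. For compositions $\beta,\gamma$ of length $n$, $\beta\le\gamma$ means $\lambda(\beta)=\lambda(\gamma)$ and $w(\beta)\le w(\gamma)$ in the Bruhat order on $S_n$. -}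

module Defs where

open import Data.Nat using (ℕ; zero; suc; _≤_; _<_; _≤ᵇ_)
open import Data.Fin using (Fin; _≟_)
import Data.Fin.Properties as FinP
open import Data.Bool using (if_then_else_)
open import Data.Vec using (Vec; []; _∷_; lookup; map; allFin; _[_]≔_)
open import Data.List using (List; length; filter; cartesianProduct)
import Data.List as L
open import Data.Product using (Σ; ∃; ∃₂; _×_; _,_; proj₁; proj₂)
open import Data.Sum using (_⊎_)
open import Relation.Nullary.Decidable using (_×-dec_; ⌊_⌋)
open import Relation.Binary.PropositionalEquality using (_≡_)
open import Relation.Binary.Construct.Closure.ReflexiveTransitive using (Star)

Composition : ℕ → Set
Composition n = Vec ℕ n

-- A permutation w ∈ S_n is represented by its one-line word w₁⋯wₙ
-- (0-indexed values in Fin n); it is a permutation iff injective.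
Word : ℕ → Set
Word n = Vec (Fin n) n

IsPerm : {n : ℕ} → Word n → Set
IsPerm {n} w = (i j : Fin n) → lookup w i ≡ lookup w j → i ≡ j

_·_ : {A : Set} {n : ℕ} → Vec A n → Word n → Vec A n
v · w = map (lookup v) w

swapPos : {A : Set} {n : ℕ} → Vec A n → Fin n → Fin n → Vec A n
swapPos v i j = (v [ i ]≔ lookup v j) [ j ]≔ lookup v i

transp : {n : ℕ} → Fin n → Fin n → Word n
transp i j = swapPos (allFin _) i j

-- Adjacent transposition s_r = (r, r+1) in S_{m+1}, 0-indexed r : Fin m
-- (positions inject₁ r and suc r).
s : {m : ℕ} → Fin m → Word (suc m)
s r = transp (Data.Fin.inject₁ r) (Fin.suc r)

ℓ : {n : ℕ} → Word n → ℕ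
ℓ {n} w = length (filter (λ p → (proj₁ p FinP.<? proj₂ p)
                               ×-dec (lookup w (proj₂ p) FinP.<? lookup w (proj₁ p)))
                         (cartesianProduct (L.allFin n) (L.allFin n)))

BruhatStep : {n : ℕ} → Word n → Word n → Set
BruhatStep {n} w u = Σ (Fin n) λ i → Σ (Fin n) λ j →
  (i Data.Fin.< j) × (u ≡ w · transp i j) × (ℓ w < ℓ u)

_≤Bruhat_ : {n : ℕ} → Word n → Word n → Set
_≤Bruhat_ = Star BruhatStep

-- λ(γ): sort the parts decreasingly (insertion sort).
insertDesc : {n : ℕ} → ℕ → Vec ℕ n → Vec ℕ (suc n)
insertDesc x [] = x ∷ []
insertDesc x (y ∷ ys) = if y ≤ᵇ x then x ∷ y ∷ ys else y ∷ insertDesc x ys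

partitionOf : {n : ℕ} → Composition n → Composition n
partitionOf [] = []
partitionOf (x ∷ xs) = insertDesc x (partitionOf xs)

IsMinPerm : {n : ℕ} → Composition n → Word n → Set
IsMinPerm {n} γ w = IsPerm w × (partitionOf γ · w ≡ γ)
  × ((u : Word n) → IsPerm u → partitionOf γ · u ≡ γ → ℓ w ≤ ℓ u)

_≼_ : {n : ℕ} → Composition n → Composition n → Set
_≼_ {n} β γ = (partitionOf β ≡ partitionOf γ) ×
  ∃₂ λ (wβ wγ : Word n) → IsMinPerm β wβ × IsMinPerm γ wγ × (wβ ≤Bruhat wγ)

V : {n : ℕ} → Composition n → Composition n → Set
V γ β = β ≼ γ

-- Write s = s_r and say that a permutation w has an ascent at r if w_r < w_{r+1}.
-- As λ(γ·s) = λ(γ), minimality of lengths gives w(γ·s) = w(γ)·s whenever γ_r ≠ γ_{r+1};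
-- moreover w(γ) has a descent at r if γ_r < γ_{r+1} and an ascent otherwise.
-- The rest is the lifting property of the Bruhat order: min(x, x·s) and max(x, x·s) are
-- monotone in x. It suffices to check one step y = x·t: unless t = s, conjugating by s
-- gives the step x·s → y·s, and in every combination of ascents and descents of x and y
-- the required chains are composed of this step, x → y, and the steps between u and u·s.
-- Now let α_r < α_{r+1}. Then w(α) = w(α·s)·s lies above w(α·s), so V(α·s) ⊆ V(α), and
-- lifting gives V(α·s)·s ⊆ V(α). Conversely, monotonicity of min applied to
-- w(β) ≤ w(α) puts β into V(α·s) if w(β) has an ascent at r, and β·s otherwise.

module Submission where

open import Defs
open import Data.Nat using (ℕ; suc; _<_)
open import Data.Fin using (Fin; inject₁)
open import Data.Vec using (Vec; lookup)
open import Data.Product using (Σ; _×_)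
open import Data.Sum using (_⊎_)
open import Function.Bundles using (_⇔_)
open import Relation.Binary.PropositionalEquality using (_≡_)

open import Data.Bool using (Bool; true; false; _∧_)
open import Data.Empty using (⊥-elim)
open import Data.Fin as Fin using (toℕ)
import Data.Fin.Properties as Fin
open import Data.Fin.Permutation.Components using (transpose)
open import Data.List as List using (List; length; filter; tabulate; cartesianProduct; _++_)
open import Data.List.Properties using (length-++; filter-++; map-tabulate)
open import Data.Nat as ℕ using (zero; _+_; _≤_; _≥_; z≤n; s≤s)
open import Data.Nat.Properties as ℕ
  using (+-assoc; +-suc; +-cancelʳ-≡; +-cancelʳ-≤; +-monoʳ-≤; +-monoʳ-<; +-mono-≤-<;
         <-asym; <-trans; m≤n+m; module ≤-Reasoning)
open import Data.Nat.Solver using (module +-*-Solver)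
open import Data.Product using (_,_; proj₁; proj₂)
open import Data.Sum using (inj₁; inj₂; [_,_])
open import Data.Vec as Vec using ([]; _∷_; _[_]≔_)
open import Data.Vec.Properties
  using ([]≔-lookup; lookup∘update; lookup∘update′; lookup-map; tabulate∘lookup; tabulate-cong; lookup-allFin)
open import Data.Vec.Relation.Unary.All as All using (All; []; _∷_)
open import Data.Vec.Relation.Unary.All.Properties using (lookup⁺)
open import Data.Vec.Relation.Unary.AllPairs using (AllPairs; []; _∷_)
open import Function using (_∘_; id)
open import Function.Bundles using (mk⇔)
open import Level using (0ℓ)
open import Relation.Binary using (tri<; tri≈; tri>)
open import Relation.Binary.Construct.Closure.ReflexiveTransitive using (ε; _◅_; _◅◅_)
open import Relation.Binary.PropositionalEquality
  using (refl; sym; trans; cong; cong₂; subst; subst₂; _≢_; module ≡-Reasoning)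
open import Relation.Nullary using (¬_; Dec; yes; no; does)
open import Relation.Nullary.Decidable using (dec-true; dec-false; _×-dec_)
open import Relation.Unary using (Pred; Decidable)

private
  variable
    n : ℕ

𝟙 : Bool → ℕ
𝟙 true = 1
𝟙 false = 0

[_<_] : ℕ → ℕ → ℕ
[ x < y ] = 𝟙 (does (x ℕ.<? y))

[<]-yes : ∀ {x y} → x < y → [ x < y ] ≡ 1
[<]-yes {x} {y} x<y = cong 𝟙 (dec-true (x ℕ.<? y) x<y)

[<]-no : ∀ {x y} → ¬ x < y → [ x < y ] ≡ 0
[<]-no {x} {y} x≮y = cong 𝟙 (dec-false (x ℕ.<? y) x≮y)

countBelow : ℕ → Vec ℕ n → ℕ
countBelow z [] = 0
countBelow z (y ∷ ys) = [ y < z ] + countBelow z ys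

inversions : Vec ℕ n → ℕ
inversions [] = 0
inversions (x ∷ xs) = countBelow x xs + inversions xs

countBelow-update : ∀ z (v : Vec ℕ n) k x y →
  countBelow z (v [ k ]≔ x) + [ y < z ] ≡ countBelow z (v [ k ]≔ y) + [ x < z ]
countBelow-update z (u ∷ v) Fin.zero x y =
  solve 3 (λ X Y C → (X :+ C) :+ Y := (Y :+ C) :+ X) refl [ x < z ] [ y < z ] (countBelow z v)
  where open +-*-Solver
countBelow-update z (u ∷ v) (Fin.suc k) x y = begin
  [ u < z ] + countBelow z (v [ k ]≔ x) + [ y < z ]    ≡⟨ +-assoc [ u < z ] _ _ ⟩
  [ u < z ] + (countBelow z (v [ k ]≔ x) + [ y < z ])  ≡⟨ cong ([ u < z ] +_) (countBelow-update z v k x y) ⟩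
  [ u < z ] + (countBelow z (v [ k ]≔ y) + [ x < z ])  ≡⟨ +-assoc [ u < z ] _ _ ⟨
  [ u < z ] + countBelow z (v [ k ]≔ y) + [ x < z ]    ∎
  where open ≡-Reasoning

lookup∘update-same-value : ∀ {A : Set} (v : Vec A n) i j (x : A) → lookup v j ≡ x →
  lookup (v [ i ]≔ x) j ≡ x
lookup∘update-same-value v i j x vj≡x with i Fin.≟ j
... | yes refl = lookup∘update i v x
... | no i≢j = trans (lookup∘update′ (λ j≡i → i≢j (sym j≡i)) v x) vj≡x

countBelow-swapPos : ∀ z (v : Vec ℕ n) i j → countBelow z (swapPos v i j) ≡ countBelow z v
countBelow-swapPos z v i j = +-cancelʳ-≡ [ vj < z ] _ _ (begin
  countBelow z ((v [ i ]≔ vj) [ j ]≔ vi) + [ vj < z ]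
    ≡⟨ cong (λ y → countBelow z ((v [ i ]≔ vj) [ j ]≔ vi) + [ y < z ]) vi≔vj-at-j ⟨
  countBelow z ((v [ i ]≔ vj) [ j ]≔ vi) + [ lookup (v [ i ]≔ vj) j < z ]
    ≡⟨ countBelow-update z (v [ i ]≔ vj) j vi _ ⟩
  countBelow z ((v [ i ]≔ vj) [ j ]≔ lookup (v [ i ]≔ vj) j) + [ vi < z ]
    ≡⟨ cong (λ u → countBelow z u + [ vi < z ]) ([]≔-lookup (v [ i ]≔ vj) j) ⟩
  countBelow z (v [ i ]≔ vj) + [ vi < z ]  ≡⟨ countBelow-update z v i vj vi ⟩
  countBelow z (v [ i ]≔ vi) + [ vj < z ]  ≡⟨ cong (λ u → countBelow z u + [ vj < z ]) ([]≔-lookup v i) ⟩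
  countBelow z v + [ vj < z ]              ∎)
  where
  open ≡-Reasoning
  vi = lookup v i
  vj = lookup v j
  vi≔vj-at-j : lookup (v [ i ]≔ vj) j ≡ vj
  vi≔vj-at-j = lookup∘update-same-value v i j vj refl

[<]-exchange : ∀ {x y} z → x < y → [ z < x ] + [ y < z ] ≤ [ z < y ] + [ x < z ]
[<]-exchange {x} {y} z x<y with z ℕ.<? x
... | yes z<x rewrite [<]-yes z<x | [<]-yes (<-trans z<x x<y)
                    | [<]-no {y} {z} (λ y<z → <-asym z<x (<-trans x<y y<z)) = s≤s z≤n
... | no z≮x rewrite [<]-no z≮x with y ℕ.<? z
...   | yes y<z rewrite [<]-yes y<z | [<]-yes (<-trans x<y y<z) = m≤n+m 1 [ z < y ]
...   | no y≮z rewrite [<]-no y≮z = z≤n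

inversions-raise-head : ∀ {x y} (v : Vec ℕ n) k → x < y →
  inversions (x ∷ (v [ k ]≔ y)) < inversions (y ∷ (v [ k ]≔ x))
inversions-raise-head {x = x} {y} (_ ∷ v) Fin.zero x<y rewrite [<]-no (<-asym x<y) | [<]-yes x<y =
  ℕ.≤-reflexive (solve 3 (λ X Y I → con 1 :+ ((con 0 :+ X) :+ (Y :+ I)) := (con 1 :+ Y) :+ (X :+ I))
                         refl (countBelow x v) (countBelow y v) (inversions v))
  where open +-*-Solver
inversions-raise-head {x = x} {y} (z ∷ v) (Fin.suc k) x<y = begin-strict
  ([ z < x ] + countBelow x vy) + (countBelow z vy + inversions vy)
    ≡⟨ shuffle [ z < x ] (countBelow x vy) (countBelow z vy) (inversions vy) ⟩
  ([ z < x ] + countBelow z vy) + (countBelow x vy + inversions vy)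
    <⟨ +-mono-≤-< tail-counts (inversions-raise-head v k x<y) ⟩
  ([ z < y ] + countBelow z vx) + (countBelow y vx + inversions vx)
    ≡⟨ shuffle [ z < y ] (countBelow z vx) (countBelow y vx) (inversions vx) ⟩
  ([ z < y ] + countBelow y vx) + (countBelow z vx + inversions vx) ∎
  where
  open ≤-Reasoning
  open +-*-Solver
  vx = v [ k ]≔ x
  vy = v [ k ]≔ y
  shuffle : ∀ a b c d → (a + b) + (c + d) ≡ (a + c) + (b + d)
  shuffle = solve 4 (λ a b c d → (a :+ b) :+ (c :+ d) := (a :+ c) :+ (b :+ d)) refl
  tail-counts : [ z < x ] + countBelow z vy ≤ [ z < y ] + countBelow z vx
  tail-counts = +-cancelʳ-≤ [ x < z ] _ _ (begin
    [ z < x ] + countBelow z vy + [ x < z ]    ≡⟨ +-assoc [ z < x ] _ _ ⟩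
    [ z < x ] + (countBelow z vy + [ x < z ])  ≡⟨ cong ([ z < x ] +_) (countBelow-update z v k y x) ⟩
    [ z < x ] + (countBelow z vx + [ y < z ])
      ≡⟨ solve 3 (λ a b c → a :+ (b :+ c) := b :+ (a :+ c)) refl [ z < x ] (countBelow z vx) [ y < z ] ⟩
    countBelow z vx + ([ z < x ] + [ y < z ])  ≤⟨ +-monoʳ-≤ (countBelow z vx) ([<]-exchange z x<y) ⟩
    countBelow z vx + ([ z < y ] + [ x < z ])
      ≡⟨ solve 3 (λ a b c → a :+ (b :+ c) := b :+ a :+ c) refl (countBelow z vx) [ z < y ] [ x < z ] ⟩
    [ z < y ] + countBelow z vx + [ x < z ]    ∎)

inversions-swap-ascent : ∀ (v : Vec ℕ n) i j → i Fin.< j → lookup v i < lookup v j →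
  inversions v < inversions (swapPos v i j)
inversions-swap-ascent (x ∷ v) Fin.zero (Fin.suc j) _ x<y =
  subst (λ u → inversions (x ∷ u) < inversions (lookup v j ∷ (v [ j ]≔ x)))
        ([]≔-lookup v j) (inversions-raise-head v j x<y)
inversions-swap-ascent (x ∷ v) (Fin.suc i) (Fin.suc j) (s≤s i<j) vi<vj =
  subst (λ c → c + inversions v < countBelow x (swapPos v i j) + inversions (swapPos v i j))
        (countBelow-swapPos x v i j)
        (+-monoʳ-< (countBelow x (swapPos v i j)) (inversions-swap-ascent v i j i<j vi<vj))

inversions-swap-adjacent-ascent : (v : Vec ℕ (suc n)) (r : Fin n) → lookup v (inject₁ r) < lookup v (Fin.suc r) →
  inversions (swapPos v (inject₁ r) (Fin.suc r)) ≡ suc (inversions v)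
inversions-swap-adjacent-ascent (x ∷ y ∷ v) Fin.zero x<y rewrite [<]-no (<-asym x<y) | [<]-yes x<y =
  solve 3 (λ Y X I → (con 1 :+ Y) :+ (X :+ I) := con 1 :+ ((con 0 :+ X) :+ (Y :+ I)))
        refl (countBelow y v) (countBelow x v) (inversions v)
  where open +-*-Solver
inversions-swap-adjacent-ascent (x ∷ v) (Fin.suc r) asc = begin
  countBelow x (swapPos v (inject₁ r) (Fin.suc r)) + inversions (swapPos v (inject₁ r) (Fin.suc r))
    ≡⟨ cong₂ _+_ (countBelow-swapPos x v (inject₁ r) (Fin.suc r)) (inversions-swap-adjacent-ascent v r asc) ⟩
  countBelow x v + suc (inversions v)  ≡⟨ +-suc (countBelow x v) (inversions v) ⟩
  suc (countBelow x v + inversions v)  ∎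
  where open ≡-Reasoning

∑ : (Fin n → ℕ) → ℕ
∑ {zero} f = 0
∑ {suc n} f = f Fin.zero + ∑ (f ∘ Fin.suc)

∑-cong : {f g : Fin n → ℕ} → (∀ k → f k ≡ g k) → ∑ f ≡ ∑ g
∑-cong {zero} f≗g = refl
∑-cong {suc n} f≗g = cong₂ _+_ (f≗g Fin.zero) (∑-cong (f≗g ∘ Fin.suc))

length-filter-tabulate : ∀ {A : Set} {P : Pred A 0ℓ} (P? : Decidable P) (f : Fin n → A) →
  length (filter P? (tabulate f)) ≡ ∑ (λ k → 𝟙 (does (P? (f k))))
length-filter-tabulate {zero} P? f = refl
length-filter-tabulate {suc n} P? f with does (P? (f Fin.zero))
... | true = cong suc (length-filter-tabulate P? (f ∘ Fin.suc))
... | false = length-filter-tabulate P? (f ∘ Fin.suc)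

length-filter-cartesianProduct : ∀ {A B : Set} {P : Pred (A × B) 0ℓ} (P? : Decidable P) (f : Fin n → A) (ys : List B) →
  length (filter P? (cartesianProduct (tabulate f) ys)) ≡ ∑ (λ k → length (filter P? (List.map (f k ,_) ys)))
length-filter-cartesianProduct {zero} P? f ys = refl
length-filter-cartesianProduct {suc n} P? f ys = begin
  length (filter P? (row ++ rest))                  ≡⟨ cong length (filter-++ P? row rest) ⟩
  length (filter P? row ++ filter P? rest)          ≡⟨ length-++ (filter P? row) ⟩
  length (filter P? row) + length (filter P? rest)  ≡⟨ cong (length (filter P? row) +_)
                                                           (length-filter-cartesianProduct P? (f ∘ Fin.suc) ys) ⟩
  ∑ (λ k → length (filter P? (List.map (f k ,_) ys))) ∎
  where
  open ≡-Reasoning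
  row = List.map (f Fin.zero ,_) ys
  rest = cartesianProduct (tabulate (f ∘ Fin.suc)) ys

countBelow≡∑ : ∀ x (v : Vec ℕ n) → countBelow x v ≡ ∑ (λ q → [ lookup v q < x ])
countBelow≡∑ x [] = refl
countBelow≡∑ x (y ∷ v) = cong ([ y < x ] +_) (countBelow≡∑ x v)

inversions≡∑ : (v : Vec ℕ n) →
  inversions v ≡ ∑ (λ p → ∑ (λ q → 𝟙 (does (toℕ p ℕ.<? toℕ q) ∧ does (lookup v q ℕ.<? lookup v p))))
inversions≡∑ [] = refl
inversions≡∑ (x ∷ v) = cong₂ _+_ (countBelow≡∑ x v) (inversions≡∑ v)

ℓ≡inversions : (w : Word n) → ℓ w ≡ inversions (Vec.map toℕ w)
ℓ≡inversions {n} w = begin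
  ℓ w  ≡⟨ length-filter-cartesianProduct Inv? id (List.allFin n) ⟩
  ∑ (λ p → length (filter Inv? (List.map (p ,_) (List.allFin n))))
       ≡⟨ ∑-cong (λ p → cong (length ∘ filter Inv?) (map-tabulate id (p ,_))) ⟩
  ∑ (λ p → length (filter Inv? (tabulate (p ,_))))
       ≡⟨ ∑-cong (λ p → length-filter-tabulate Inv? (p ,_)) ⟩
  ∑ (λ p → ∑ (λ q → 𝟙 (does (Inv? (p , q)))))
       ≡⟨ ∑-cong (λ p → ∑-cong (λ q → cong₂ (λ x y → 𝟙 (does (toℕ p ℕ.<? toℕ q) ∧ does (x ℕ.<? y)))
                                             (sym (lookup-map q toℕ w)) (sym (lookup-map p toℕ w)))) ⟩
  ∑ (λ p → ∑ (λ q → 𝟙 (does (toℕ p ℕ.<? toℕ q) ∧ does (lookup (Vec.map toℕ w) q ℕ.<? lookup (Vec.map toℕ w) p))))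
       ≡⟨ inversions≡∑ (Vec.map toℕ w) ⟨
  inversions (Vec.map toℕ w) ∎
  where
  open ≡-Reasoning
  -- Fin._<?_ unfolds to ℕ._<?_ on toℕ, so only lookup-map is needed to reach inversions≡∑.
  Inv? : Decidable (λ (pq : Fin n × Fin n) → (proj₁ pq Fin.< proj₂ pq) × (lookup w (proj₂ pq) Fin.< lookup w (proj₁ pq)))
  Inv? (p , q) = (p Fin.<? q) ×-dec (lookup w q Fin.<? lookup w p)

transpose-matchˡ : (i j : Fin n) → transpose i j i ≡ j
transpose-matchˡ i j rewrite dec-true (i Fin.≟ i) refl = refl

transpose-matchʳ : (i j : Fin n) → transpose i j j ≡ i
transpose-matchʳ i j with j Fin.≟ i
... | yes j≡i = j≡i
... | no _ rewrite dec-true (j Fin.≟ j) refl = refl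

transpose-other : ∀ {i j k : Fin n} → k ≢ i → k ≢ j → transpose i j k ≡ k
transpose-other {i = i} {j} {k} k≢i k≢j rewrite dec-false (k Fin.≟ i) k≢i | dec-false (k Fin.≟ j) k≢j = refl

transpose-involutive : (i j k : Fin n) → transpose i j (transpose i j k) ≡ k
transpose-involutive i j k = go i j k (k Fin.≟ i) (k Fin.≟ j)
  where
  go : (i j k : Fin n) → Dec (k ≡ i) → Dec (k ≡ j) → transpose i j (transpose i j k) ≡ k
  go i j i (yes refl) _ = trans (cong (transpose i j) (transpose-matchˡ i j)) (transpose-matchʳ i j)
  go i j j (no _) (yes refl) = trans (cong (transpose i j) (transpose-matchʳ i j)) (transpose-matchˡ i j)
  go i j k (no k≢i) (no k≢j) = trans (cong (transpose i j) (transpose-other k≢i k≢j)) (transpose-other k≢i k≢j)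

transpose-natural : (f : Fin n → Fin n) → (∀ {x y} → f x ≡ f y → x ≡ y) → (i j k : Fin n) →
  f (transpose i j k) ≡ transpose (f i) (f j) (f k)
transpose-natural f f-inj i j k = go i j k (k Fin.≟ i) (k Fin.≟ j)
  where
  go : (i j k : Fin _) → Dec (k ≡ i) → Dec (k ≡ j) → f (transpose i j k) ≡ transpose (f i) (f j) (f k)
  go i j i (yes refl) _ = trans (cong f (transpose-matchˡ i j)) (sym (transpose-matchˡ (f i) (f j)))
  go i j j (no _) (yes refl) = trans (cong f (transpose-matchʳ i j)) (sym (transpose-matchʳ (f i) (f j)))
  go i j k (no k≢i) (no k≢j) =
    trans (cong f (transpose-other k≢i k≢j)) (sym (transpose-other (k≢i ∘ f-inj) (k≢j ∘ f-inj)))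

lookup-swapPos : ∀ {A : Set} (v : Vec A n) i j k → lookup (swapPos v i j) k ≡ lookup v (transpose i j k)
lookup-swapPos v i j k = go i j k (k Fin.≟ j) (k Fin.≟ i)
  where
  open ≡-Reasoning
  go : ∀ i j k → Dec (k ≡ j) → Dec (k ≡ i) → lookup (swapPos v i j) k ≡ lookup v (transpose i j k)
  go i j j (yes refl) _ = begin
    lookup ((v [ i ]≔ lookup v j) [ j ]≔ lookup v i) j  ≡⟨ lookup∘update j (v [ i ]≔ lookup v j) (lookup v i) ⟩
    lookup v i                                          ≡⟨ cong (lookup v) (transpose-matchʳ i j) ⟨
    lookup v (transpose i j j)                          ∎
  go i j i (no i≢j) (yes refl) = begin
    lookup ((v [ i ]≔ lookup v j) [ j ]≔ lookup v i) i  ≡⟨ lookup∘update′ i≢j (v [ i ]≔ lookup v j) (lookup v i) ⟩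
    lookup (v [ i ]≔ lookup v j) i                      ≡⟨ lookup∘update i v (lookup v j) ⟩
    lookup v j                                          ≡⟨ cong (lookup v) (transpose-matchˡ i j) ⟨
    lookup v (transpose i j i)                          ∎
  go i j k (no k≢j) (no k≢i) = begin
    lookup ((v [ i ]≔ lookup v j) [ j ]≔ lookup v i) k  ≡⟨ lookup∘update′ k≢j (v [ i ]≔ lookup v j) (lookup v i) ⟩
    lookup (v [ i ]≔ lookup v j) k                      ≡⟨ lookup∘update′ k≢i v (lookup v j) ⟩
    lookup v k                                          ≡⟨ cong (lookup v) (transpose-other k≢i k≢j) ⟨
    lookup v (transpose i j k)                          ∎

lookup-extensionality : ∀ {A : Set} {u v : Vec A n} → (∀ k → lookup u k ≡ lookup v k) → u ≡ v
lookup-extensionality {u = u} {v} u≗v = begin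
  u                        ≡⟨ tabulate∘lookup u ⟨
  Vec.tabulate (lookup u)  ≡⟨ tabulate-cong u≗v ⟩
  Vec.tabulate (lookup v)  ≡⟨ tabulate∘lookup v ⟩
  v                        ∎
  where open ≡-Reasoning

lookup-· : ∀ {A : Set} (v : Vec A n) (w : Word n) k → lookup (v · w) k ≡ lookup v (lookup w k)
lookup-· v w k = lookup-map k (lookup v) w

lookup-·transp : ∀ {A : Set} (v : Vec A n) i j k → lookup (v · transp i j) k ≡ lookup v (transpose i j k)
lookup-·transp v i j k = begin
  lookup (v · transp i j) k                           ≡⟨ lookup-· v (transp i j) k ⟩
  lookup v (lookup (transp i j) k)                    ≡⟨ cong (lookup v) (lookup-swapPos (Vec.allFin _) i j k) ⟩
  lookup v (lookup (Vec.allFin _) (transpose i j k))  ≡⟨ cong (lookup v) (lookup-allFin _) ⟩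
  lookup v (transpose i j k)                          ∎
  where open ≡-Reasoning

lookup-·transpˡ : ∀ {A : Set} (v : Vec A n) i j → lookup (v · transp i j) i ≡ lookup v j
lookup-·transpˡ v i j = trans (lookup-·transp v i j i) (cong (lookup v) (transpose-matchˡ i j))

lookup-·transpʳ : ∀ {A : Set} (v : Vec A n) i j → lookup (v · transp i j) j ≡ lookup v i
lookup-·transpʳ v i j = trans (lookup-·transp v i j j) (cong (lookup v) (transpose-matchʳ i j))

·transp≡swapPos : ∀ {A : Set} (v : Vec A n) i j → v · transp i j ≡ swapPos v i j
·transp≡swapPos v i j = lookup-extensionality λ k → trans (lookup-·transp v i j k) (sym (lookup-swapPos v i j k))

·-assoc : ∀ {A : Set} (v : Vec A n) (w u : Word n) → (v · w) · u ≡ v · (w · u)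
·-assoc v w u = lookup-extensionality λ k → begin
  lookup ((v · w) · u) k            ≡⟨ lookup-· (v · w) u k ⟩
  lookup (v · w) (lookup u k)       ≡⟨ lookup-· v w (lookup u k) ⟩
  lookup v (lookup w (lookup u k))  ≡⟨ cong (lookup v) (lookup-· w u k) ⟨
  lookup v (lookup (w · u) k)       ≡⟨ lookup-· v (w · u) k ⟨
  lookup (v · (w · u)) k            ∎
  where open ≡-Reasoning

map-· : ∀ {A B : Set} (f : A → B) (v : Vec A n) (w : Word n) → Vec.map f (v · w) ≡ Vec.map f v · w
map-· f v w = lookup-extensionality λ k → begin
  lookup (Vec.map f (v · w)) k       ≡⟨ lookup-map k f (v · w) ⟩
  f (lookup (v · w) k)               ≡⟨ cong f (lookup-· v w k) ⟩
  f (lookup v (lookup w k))          ≡⟨ lookup-map (lookup w k) f v ⟨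
  lookup (Vec.map f v) (lookup w k)  ≡⟨ lookup-· (Vec.map f v) w k ⟨
  lookup (Vec.map f v · w) k         ∎
  where open ≡-Reasoning

·transp-involutive : ∀ {A : Set} (v : Vec A n) i j → (v · transp i j) · transp i j ≡ v
·transp-involutive v i j = lookup-extensionality λ k →
  trans (lookup-·transp (v · transp i j) i j k)
        (trans (lookup-·transp v i j (transpose i j k)) (cong (lookup v) (transpose-involutive i j k)))

transpose-injective : (a b : Fin n) {x y : Fin n} → transpose a b x ≡ transpose a b y → x ≡ y
transpose-injective a b {x} {y} σx≡σy =
  trans (sym (transpose-involutive a b x)) (trans (cong (transpose a b) σx≡σy) (transpose-involutive a b y))

·transp-conj : ∀ {A : Set} (v : Vec A n) i j a b →
  (v · transp i j) · transp a b ≡ (v · transp a b) · transp (transpose a b i) (transpose a b j)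
·transp-conj v i j a b = lookup-extensionality λ k → begin
  lookup ((v · transp i j) · transp a b) k        ≡⟨ lookup-·transp (v · transp i j) a b k ⟩
  lookup (v · transp i j) (σ k)                   ≡⟨ lookup-·transp v i j (σ k) ⟩
  lookup v (transpose i j (σ k))                  ≡⟨ cong₂ (λ x y → lookup v (transpose x y (σ k)))
                                                           (transpose-involutive a b i) (transpose-involutive a b j) ⟨
  lookup v (transpose (σ (σ i)) (σ (σ j)) (σ k))
    ≡⟨ cong (lookup v) (transpose-natural σ (transpose-injective a b) (σ i) (σ j) k) ⟨
  lookup v (σ (transpose (σ i) (σ j) k))          ≡⟨ lookup-·transp v a b _ ⟨
  lookup (v · transp a b) (transpose (σ i) (σ j) k) ≡⟨ lookup-·transp (v · transp a b) (σ i) (σ j) k ⟨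
  lookup ((v · transp a b) · transp (σ i) (σ j)) k  ∎
  where
  open ≡-Reasoning
  σ = transpose a b

IsPerm-·transp : (w : Word n) (i j : Fin n) → IsPerm w → IsPerm (w · transp i j)
IsPerm-·transp w i j w-inj x y wtx≡wty = transpose-injective i j (w-inj _ _ (begin
  lookup w (transpose i j x)  ≡⟨ lookup-·transp w i j x ⟨
  lookup (w · transp i j) x   ≡⟨ wtx≡wty ⟩
  lookup (w · transp i j) y   ≡⟨ lookup-·transp w i j y ⟩
  lookup w (transpose i j y)  ∎))
  where open ≡-Reasoning

ℓ-·transp-ascent : (w : Word n) {i j : Fin n} → i Fin.< j → lookup w i Fin.< lookup w j → ℓ w < ℓ (w · transp i j)
ℓ-·transp-ascent w {i} {j} i<j wi<wj = begin-strict
  ℓ w                                        ≡⟨ ℓ≡inversions w ⟩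
  inversions (Vec.map toℕ w)                 <⟨ inversions-swap-ascent (Vec.map toℕ w) i j i<j
                                                  (subst₂ _<_ (sym (lookup-map i toℕ w)) (sym (lookup-map j toℕ w)) wi<wj) ⟩
  inversions (swapPos (Vec.map toℕ w) i j)   ≡⟨ cong inversions (·transp≡swapPos (Vec.map toℕ w) i j) ⟨
  inversions (Vec.map toℕ w · transp i j)    ≡⟨ cong inversions (map-· toℕ w (transp i j)) ⟨
  inversions (Vec.map toℕ (w · transp i j))  ≡⟨ ℓ≡inversions (w · transp i j) ⟨
  ℓ (w · transp i j)                         ∎
  where open ≤-Reasoning

ℓ-·s-ascent : (w : Word (suc n)) (r : Fin n) → lookup w (inject₁ r) Fin.< lookup w (Fin.suc r) → ℓ (w · s r) ≡ suc (ℓ w)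
ℓ-·s-ascent w r asc = begin
  ℓ (w · s r)                       ≡⟨ ℓ≡inversions (w · s r) ⟩
  inversions (Vec.map toℕ (w · s r)) ≡⟨ cong inversions (trans (map-· toℕ w (s r)) (·transp≡swapPos (Vec.map toℕ w) _ _)) ⟩
  inversions (swapPos (Vec.map toℕ w) (inject₁ r) (Fin.suc r))
    ≡⟨ inversions-swap-adjacent-ascent (Vec.map toℕ w) r
         (subst₂ _<_ (sym (lookup-map (inject₁ r) toℕ w)) (sym (lookup-map (Fin.suc r) toℕ w)) asc) ⟩
  suc (inversions (Vec.map toℕ w))  ≡⟨ cong suc (ℓ≡inversions w) ⟨
  suc (ℓ w)                         ∎
  where open ≡-Reasoning

insertDesc-head : ∀ {x y} (ys : Vec ℕ n) → y ≤ x → insertDesc x (y ∷ ys) ≡ x ∷ y ∷ ys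
insertDesc-head {x = x} {y} ys y≤x rewrite dec-true (y ℕ.≤? x) y≤x = refl

insertDesc-tail : ∀ {x y} (ys : Vec ℕ n) → x < y → insertDesc x (y ∷ ys) ≡ y ∷ insertDesc x ys
insertDesc-tail {x = x} {y} ys x<y rewrite dec-false (y ℕ.≤? x) (ℕ.<⇒≱ x<y) = refl

insertDesc-exchange : ∀ a b (t : Vec ℕ n) → insertDesc a t ≡ a ∷ t → insertDesc b t ≡ b ∷ t →
  insertDesc a (b ∷ t) ≡ insertDesc b (a ∷ t)
insertDesc-exchange a b t a∷t b∷t with ℕ.<-cmp a b
... | tri< a<b _ _ = trans (insertDesc-tail t a<b) (trans (cong (b ∷_) a∷t) (sym (insertDesc-head t (ℕ.<⇒≤ a<b))))
... | tri≈ _ refl _ = refl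
... | tri> _ _ b<a = trans (insertDesc-head t (ℕ.<⇒≤ b<a)) (sym (trans (insertDesc-tail t b<a) (cong (a ∷_) b∷t)))

insertDesc-comm : ∀ a b (t : Vec ℕ n) → insertDesc a (insertDesc b t) ≡ insertDesc b (insertDesc a t)
insertDesc-comm a b [] = insertDesc-exchange a b [] refl refl
insertDesc-comm a b (y ∷ t) with y ℕ.≤? b | y ℕ.≤? a
... | yes y≤b | yes y≤a = begin
  insertDesc a (insertDesc b (y ∷ t))  ≡⟨ cong (insertDesc a) (insertDesc-head t y≤b) ⟩
  insertDesc a (b ∷ y ∷ t)             ≡⟨ insertDesc-exchange a b (y ∷ t) (insertDesc-head t y≤a) (insertDesc-head t y≤b) ⟩
  insertDesc b (a ∷ y ∷ t)             ≡⟨ cong (insertDesc b) (insertDesc-head t y≤a) ⟨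
  insertDesc b (insertDesc a (y ∷ t))  ∎
  where open ≡-Reasoning
... | yes y≤b | no y≰a = begin
  insertDesc a (insertDesc b (y ∷ t))  ≡⟨ cong (insertDesc a) (insertDesc-head t y≤b) ⟩
  insertDesc a (b ∷ y ∷ t)             ≡⟨ insertDesc-tail (y ∷ t) (ℕ.<-≤-trans a<y y≤b) ⟩
  b ∷ insertDesc a (y ∷ t)             ≡⟨ cong (b ∷_) (insertDesc-tail t a<y) ⟩
  b ∷ y ∷ insertDesc a t               ≡⟨ insertDesc-head (insertDesc a t) y≤b ⟨
  insertDesc b (y ∷ insertDesc a t)    ≡⟨ cong (insertDesc b) (insertDesc-tail t a<y) ⟨
  insertDesc b (insertDesc a (y ∷ t))  ∎
  where
  open ≡-Reasoning
  a<y = ℕ.≰⇒> y≰a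
... | no y≰b | yes y≤a = begin
  insertDesc a (insertDesc b (y ∷ t))  ≡⟨ cong (insertDesc a) (insertDesc-tail t b<y) ⟩
  insertDesc a (y ∷ insertDesc b t)    ≡⟨ insertDesc-head (insertDesc b t) y≤a ⟩
  a ∷ y ∷ insertDesc b t               ≡⟨ cong (a ∷_) (insertDesc-tail t b<y) ⟨
  a ∷ insertDesc b (y ∷ t)             ≡⟨ insertDesc-tail (y ∷ t) (ℕ.<-≤-trans b<y y≤a) ⟨
  insertDesc b (a ∷ y ∷ t)             ≡⟨ cong (insertDesc b) (insertDesc-head t y≤a) ⟨
  insertDesc b (insertDesc a (y ∷ t))  ∎
  where
  open ≡-Reasoning
  b<y = ℕ.≰⇒> y≰b
... | no y≰b | no y≰a = begin
  insertDesc a (insertDesc b (y ∷ t))  ≡⟨ cong (insertDesc a) (insertDesc-tail t b<y) ⟩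
  insertDesc a (y ∷ insertDesc b t)    ≡⟨ insertDesc-tail (insertDesc b t) a<y ⟩
  y ∷ insertDesc a (insertDesc b t)    ≡⟨ cong (y ∷_) (insertDesc-comm a b t) ⟩
  y ∷ insertDesc b (insertDesc a t)    ≡⟨ insertDesc-tail (insertDesc a t) b<y ⟨
  insertDesc b (y ∷ insertDesc a t)    ≡⟨ cong (insertDesc b) (insertDesc-tail t a<y) ⟨
  insertDesc b (insertDesc a (y ∷ t))  ∎
  where
  open ≡-Reasoning
  a<y = ℕ.≰⇒> y≰a
  b<y = ℕ.≰⇒> y≰b

partitionOf-swap-adjacent : (v : Vec ℕ (suc n)) (r : Fin n) → partitionOf (swapPos v (inject₁ r) (Fin.suc r)) ≡ partitionOf v
partitionOf-swap-adjacent (x ∷ y ∷ v) Fin.zero = insertDesc-comm y x (partitionOf v)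
partitionOf-swap-adjacent (x ∷ v) (Fin.suc r) = cong (insertDesc x) (partitionOf-swap-adjacent v r)

partitionOf-·s : (v : Vec ℕ (suc n)) (r : Fin n) → partitionOf (v · s r) ≡ partitionOf v
partitionOf-·s v r = trans (cong partitionOf (·transp≡swapPos v (inject₁ r) (Fin.suc r))) (partitionOf-swap-adjacent v r)

insertDesc-All : ∀ {P : Pred ℕ 0ℓ} {x} (ys : Vec ℕ n) → P x → All P ys → All P (insertDesc x ys)
insertDesc-All [] px [] = px ∷ []
insertDesc-All {x = x} (y ∷ ys) px (py ∷ pys) with y ℕ.≤? x
... | yes y≤x rewrite insertDesc-head ys y≤x = px ∷ py ∷ pys
... | no y≰x rewrite insertDesc-tail ys (ℕ.≰⇒> y≰x) = py ∷ insertDesc-All ys px pys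

Descending : Vec ℕ n → Set
Descending = AllPairs _≥_

insertDesc-descending : ∀ x (ys : Vec ℕ n) → Descending ys → Descending (insertDesc x ys)
insertDesc-descending x [] [] = [] ∷ []
insertDesc-descending x (y ∷ ys) (y≥ys ∷ desc) with y ℕ.≤? x
... | yes y≤x rewrite insertDesc-head ys y≤x =
  (y≤x ∷ All.map (λ z≤y → ℕ.≤-trans z≤y y≤x) y≥ys) ∷ y≥ys ∷ desc
... | no y≰x rewrite insertDesc-tail ys (ℕ.≰⇒> y≰x) =
  insertDesc-All ys (ℕ.<⇒≤ (ℕ.≰⇒> y≰x)) y≥ys ∷ insertDesc-descending x ys desc

partitionOf-descending : (v : Vec ℕ n) → Descending (partitionOf v)
partitionOf-descending [] = []
partitionOf-descending (x ∷ v) = insertDesc-descending x (partitionOf v) (partitionOf-descending v)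

Descending-antitone : {v : Vec ℕ n} → Descending v → ∀ {i j} → i Fin.≤ j → lookup v j ≤ lookup v i
Descending-antitone (_ ∷ _) {Fin.zero} {Fin.zero} _ = ℕ.≤-refl
Descending-antitone (x≥v ∷ _) {Fin.zero} {Fin.suc j} _ = lookup⁺ x≥v j
Descending-antitone (_ ∷ desc) {Fin.suc i} {Fin.suc j} (s≤s i≤j) = Descending-antitone desc i≤j

swapPos-equal : ∀ {A : Set} (v : Vec A n) i j → lookup v i ≡ lookup v j → swapPos v i j ≡ v
swapPos-equal v i j vi≡vj = begin
  (v [ i ]≔ lookup v j) [ j ]≔ lookup v i  ≡⟨ cong (λ x → (v [ i ]≔ x) [ j ]≔ lookup v i) vi≡vj ⟨
  (v [ i ]≔ lookup v i) [ j ]≔ lookup v i  ≡⟨ cong (_[ j ]≔ lookup v i) ([]≔-lookup v i) ⟩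
  v [ j ]≔ lookup v i                      ≡⟨ cong (v [ j ]≔_) vi≡vj ⟩
  v [ j ]≔ lookup v j                      ≡⟨ []≔-lookup v j ⟩
  v                                        ∎
  where open ≡-Reasoning

·-reverses-order : ∀ {λγ γ : Vec ℕ n} {w : Word n} → Descending λγ → λγ · w ≡ γ →
  ∀ {p q} → lookup γ p < lookup γ q → lookup w q Fin.< lookup w p
·-reverses-order {λγ = λγ} {w = w} desc refl {p} {q} γp<γq = ℕ.≰⇒> λ wp≤wq →
  ℕ.<⇒≱ (subst₂ _<_ (lookup-· λγ w p) (lookup-· λγ w q) γp<γq) (Descending-antitone desc wp≤wq)

transp-step : (w : Word n) {i j : Fin n} → i Fin.< j → lookup w i Fin.< lookup w j → BruhatStep w (w · transp i j)
transp-step w i<j wi<wj = _ , _ , i<j , refl , ℓ-·transp-ascent w i<j wi<wj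

ℓ-increase⇒ascent : (w : Word n) → IsPerm w → {i j : Fin n} → i Fin.< j → ℓ w < ℓ (w · transp i j) →
  lookup w i Fin.< lookup w j
ℓ-increase⇒ascent w w-inj {i} {j} i<j ℓw<ℓwt with Fin.<-cmp (lookup w i) (lookup w j)
... | tri< wi<wj _ _ = wi<wj
... | tri≈ _ wi≡wj _ = ⊥-elim (Fin.<⇒≢ i<j (w-inj i j wi≡wj))
... | tri> _ _ wj<wi = ⊥-elim (ℕ.<-asym ℓw<ℓwt (subst (ℓ (w · transp i j) <_) (cong ℓ (·transp-involutive w i j))
    (ℓ-·transp-ascent (w · transp i j) i<j
      (subst₂ Fin._<_ (sym (lookup-·transpˡ w i j)) (sym (lookup-·transpʳ w i j)) wj<wi))))

module AdjacentTransposition {m : ℕ} (r : Fin m) where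

  a b : Fin (suc m)
  a = inject₁ r
  b = Fin.suc r

  a<b : a Fin.< b
  a<b = Fin.≤̄⇒inject₁< Fin.≤-refl

  a<⇒b≤ : ∀ {k : Fin (suc m)} → a Fin.< k → b Fin.≤ k
  a<⇒b≤ {k} = subst (ℕ._< toℕ k) (Fin.toℕ-inject₁ r)

  <b⇒≤a : ∀ {k : Fin (suc m)} → k Fin.< b → k Fin.≤ a
  <b⇒≤a {k} k<b = subst (toℕ k ≤_) (sym (Fin.toℕ-inject₁ r)) (ℕ.≤-pred k<b)

  lookup-·s-a : ∀ {A : Set} (v : Vec A (suc m)) → lookup (v · s r) a ≡ lookup v b
  lookup-·s-a v = lookup-·transpˡ v a b

  lookup-·s-b : ∀ {A : Set} (v : Vec A (suc m)) → lookup (v · s r) b ≡ lookup v a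
  lookup-·s-b v = lookup-·transpʳ v a b

  ·s-involutive : ∀ {A : Set} (v : Vec A (suc m)) → (v · s r) · s r ≡ v
  ·s-involutive v = ·transp-involutive v a b

  ·s-fixes-equal : ∀ {A : Set} (v : Vec A (suc m)) → lookup v a ≡ lookup v b → v · s r ≡ v
  ·s-fixes-equal v va≡vb = trans (·transp≡swapPos v a b) (swapPos-equal v a b va≡vb)

  Ascent Descent : Word (suc m) → Set
  Ascent w = lookup w a Fin.< lookup w b
  Descent w = lookup w b Fin.< lookup w a

  ascent? : (w : Word (suc m)) → Dec (Ascent w)
  ascent? w = lookup w a Fin.<? lookup w b

  ¬ascent⇒descent : ∀ w → IsPerm w → ¬ Ascent w → Descent w
  ¬ascent⇒descent w w-inj ¬asc =
    Fin.≤∧≢⇒< (ℕ.≮⇒≥ ¬asc) (λ wb≡wa → Fin.<⇒≢ a<b (sym (w-inj b a wb≡wa)))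

  descent⇒·s-ascent : ∀ w → Descent w → Ascent (w · s r)
  descent⇒·s-ascent w = subst₂ Fin._<_ (sym (lookup-·s-a w)) (sym (lookup-·s-b w))

  ascent⇒·s-descent : ∀ w → Ascent w → Descent (w · s r)
  ascent⇒·s-descent w = subst₂ Fin._<_ (sym (lookup-·s-b w)) (sym (lookup-·s-a w))

  ascent-step : ∀ w → Ascent w → BruhatStep w (w · s r)
  ascent-step w = transp-step w a<b

  descent-step : ∀ w → Descent w → BruhatStep (w · s r) w
  descent-step w desc = subst (BruhatStep (w · s r)) (·s-involutive w) (ascent-step (w · s r) (descent⇒·s-ascent w desc))

  ℓ-·s-descent : ∀ w → Descent w → ℓ (w · s r) < ℓ w
  ℓ-·s-descent w desc =
    ℕ.≤-reflexive (sym (trans (cong ℓ (sym (·s-involutive w))) (ℓ-·s-ascent (w · s r) r (descent⇒·s-ascent w desc))))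

  ℓ-·s-≤ : ∀ w → IsPerm w → ℓ (w · s r) ≤ suc (ℓ w)
  ℓ-·s-≤ w w-inj with ascent? w
  ... | yes asc = ℕ.≤-reflexive (ℓ-·s-ascent w r asc)
  ... | no ¬asc = ℕ.m≤n⇒m≤1+n (ℕ.<⇒≤ (ℓ-·s-descent w (¬ascent⇒descent w w-inj ¬asc)))

  ·-·s : ∀ (λγ : Vec ℕ (suc m)) {γ} w → λγ · w ≡ γ → λγ · (w · s r) ≡ γ · s r
  ·-·s λγ w λw≡γ = trans (sym (·-assoc λγ w (s r))) (cong (_· s r) λw≡γ)

  minPerm-descent : ∀ {γ w} → IsMinPerm γ w → lookup γ a < lookup γ b → Descent w
  minPerm-descent {γ} (_ , λw≡γ , _) = ·-reverses-order {λγ = partitionOf γ} (partitionOf-descending γ) λw≡γ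

  minPerm-ascent : ∀ {γ w} → IsMinPerm γ w → lookup γ b < lookup γ a → Ascent w
  minPerm-ascent {γ} (_ , λw≡γ , _) = ·-reverses-order {λγ = partitionOf γ} (partitionOf-descending γ) λw≡γ

  minPerm-ascent-of-equal : ∀ {γ w} → IsMinPerm γ w → lookup γ a ≡ lookup γ b → Ascent w
  minPerm-ascent-of-equal {γ} {w} (w-inj , λw≡γ , minimal) γa≡γb with ascent? w
  ... | yes asc = asc
  ... | no ¬asc = ⊥-elim (ℕ.<-irrefl refl (begin-strict
    ℓ (w · s r)        <⟨ ℓ-·s-descent w (¬ascent⇒descent w w-inj ¬asc) ⟩
    ℓ w                ≤⟨ minimal (w · s r) (IsPerm-·transp w a b w-inj)
                                  (trans (·-·s (partitionOf γ) w λw≡γ) (·s-fixes-equal γ γa≡γb)) ⟩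
    ℓ (w · s r)        ∎))
    where open ≤-Reasoning

  minPerm-·s : ∀ {γ w} → IsMinPerm γ w → lookup γ a ≢ lookup γ b → IsMinPerm (γ · s r) (w · s r)
  minPerm-·s {γ} {w} (w-inj , λw≡γ , minimal) γa≢γb =
    IsPerm-·transp w a b w-inj , λ′w′≡γ′ ,
    λ u u-inj λ′u≡γ′ → bound u u-inj (trans (cong (_· u) (sym (partitionOf-·s γ r))) λ′u≡γ′)
    where
    λγ = partitionOf γ
    λ′w′≡γ′ : partitionOf (γ · s r) · (w · s r) ≡ γ · s r
    λ′w′≡γ′ = trans (cong (_· (w · s r)) (partitionOf-·s γ r)) (·-·s λγ w λw≡γ)
    ℓw≤ℓ[u·s] : ∀ u → IsPerm u → λγ · u ≡ γ · s r → ℓ w ≤ ℓ (u · s r)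
    ℓw≤ℓ[u·s] u u-inj λu≡γ′ =
      minimal (u · s r) (IsPerm-·transp u a b u-inj) (trans (·-·s λγ u λu≡γ′) (·s-involutive γ))
    bound : ∀ u → IsPerm u → λγ · u ≡ γ · s r → ℓ (w · s r) ≤ ℓ u
    bound u u-inj λu≡γ′ with ℕ.<-cmp (lookup γ a) (lookup γ b)
    ... | tri≈ _ γa≡γb _ = ⊥-elim (γa≢γb γa≡γb)
    ... | tri< γa<γb _ _ = ℕ.<⇒≤pred (begin-strict
      ℓ (w · s r)  <⟨ ℓ-·s-descent w (minPerm-descent (w-inj , λw≡γ , minimal) γa<γb) ⟩
      ℓ w          ≤⟨ ℓw≤ℓ[u·s] u u-inj λu≡γ′ ⟩
      ℓ (u · s r)  ≤⟨ ℓ-·s-≤ u u-inj ⟩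
      suc (ℓ u)    ∎)
      where open ≤-Reasoning
    ... | tri> _ _ γb<γa = begin
      ℓ (w · s r)       ≡⟨ ℓ-·s-ascent w r (minPerm-ascent (w-inj , λw≡γ , minimal) γb<γa) ⟩
      suc (ℓ w)         ≤⟨ s≤s (ℓw≤ℓ[u·s] u u-inj λu≡γ′) ⟩
      suc (ℓ (u · s r)) ≤⟨ ℓ-·s-descent u u-descent ⟩
      ℓ u               ∎
      where
      open ≤-Reasoning
      u-descent : Descent u
      u-descent = ·-reverses-order (partitionOf-descending γ) λu≡γ′
        (subst₂ _<_ (sym (lookup-·s-a γ)) (sym (lookup-·s-b γ)) γb<γa)

  transpose-ab-monotone : ∀ {i j} → i Fin.< j → ¬ (i ≡ a × j ≡ b) → transpose a b i Fin.< transpose a b j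
  transpose-ab-monotone {i} {j} = go i j (i Fin.≟ a) (i Fin.≟ b) (j Fin.≟ a) (j Fin.≟ b)
    where
    go : ∀ i j → Dec (i ≡ a) → Dec (i ≡ b) → Dec (j ≡ a) → Dec (j ≡ b) →
      i Fin.< j → ¬ (i ≡ a × j ≡ b) → transpose a b i Fin.< transpose a b j
    go i j (yes refl) _ _ (yes refl) _ ¬ab = ⊥-elim (¬ab (refl , refl))
    go i j (yes refl) _ _ (no j≢b) a<j _ =
      subst₂ Fin._<_ (sym (transpose-matchˡ a b)) (sym (transpose-other (Fin.<⇒≢ a<j ∘ sym) j≢b))
        (Fin.≤∧≢⇒< (a<⇒b≤ a<j) (j≢b ∘ sym))
    go i j (no _) (yes refl) _ _ b<j _ =
      subst₂ Fin._<_ (sym (transpose-matchʳ a b))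
        (sym (transpose-other (Fin.<⇒≢ (Fin.<-trans a<b b<j) ∘ sym) (Fin.<⇒≢ b<j ∘ sym)))
        (Fin.<-trans a<b b<j)
    go i j (no i≢a) (no i≢b) (yes refl) _ i<a _ =
      subst₂ Fin._<_ (sym (transpose-other i≢a i≢b)) (sym (transpose-matchˡ a b)) (Fin.<-trans i<a a<b)
    go i j (no i≢a) (no i≢b) (no _) (yes refl) i<b _ =
      subst₂ Fin._<_ (sym (transpose-other i≢a i≢b)) (sym (transpose-matchʳ a b)) (Fin.≤∧≢⇒< (<b⇒≤a i<b) i≢a)
    go i j (no i≢a) (no i≢b) (no j≢a) (no j≢b) i<j _ =
      subst₂ Fin._<_ (sym (transpose-other i≢a i≢b)) (sym (transpose-other j≢a j≢b)) i<j

  conj-step : ∀ x {i j} → i Fin.< j → lookup x i Fin.< lookup x j → ¬ (i ≡ a × j ≡ b) →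
    BruhatStep (x · s r) ((x · transp i j) · s r)
  conj-step x {i} {j} i<j xi<xj ¬ab =
    subst (BruhatStep (x · s r)) (sym (·transp-conj x i j a b))
      (transp-step (x · s r) (transpose-ab-monotone i<j ¬ab)
                   (subst₂ Fin._<_ (sym (xs∘σ i)) (sym (xs∘σ j)) xi<xj))
    where
    xs∘σ : ∀ k → lookup (x · s r) (transpose a b k) ≡ lookup x k
    xs∘σ k = trans (lookup-·transp x a b (transpose a b k)) (cong (lookup x) (transpose-involutive a b k))

  lower upper : Word (suc m) → Word (suc m)
  lower w with ascent? w
  ... | yes _ = w
  ... | no _ = w · s r
  upper w with ascent? w
  ... | yes _ = w · s r
  ... | no _ = w

  lower-upper-mono-step : ∀ x {y} → IsPerm x → BruhatStep x y →
    (lower x ≤Bruhat lower y) × (upper x ≤Bruhat upper y)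
  lower-upper-mono-step x x-inj step@(i , j , i<j , refl , ℓx<ℓy) with ascent? x | ascent? (x · transp i j)
  ... | yes ax | yes ay =
    step ◅ ε , conj-step x i<j xi<xj (λ { (refl , refl) → Fin.<-asym (ascent⇒·s-descent x ax) ay }) ◅ ε
    where xi<xj = ℓ-increase⇒ascent x x-inj i<j ℓx<ℓy
  ... | no ¬ax | no _ = conj-step x i<j xi<xj (λ { (refl , refl) → ¬ax xi<xj }) ◅ ε , step ◅ ε
    where xi<xj = ℓ-increase⇒ascent x x-inj i<j ℓx<ℓy
  ... | no ¬ax | yes ay =
    descent-step x (¬ascent⇒descent x x-inj ¬ax) ◅ step ◅ ε , step ◅ ascent-step (x · transp i j) ay ◅ ε
  ... | yes ax | no ¬ay with i Fin.≟ a ×-dec j Fin.≟ b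
  ...   | yes (refl , refl) = subst (x ≤Bruhat_) (sym (·s-involutive x)) ε , ε
  ...   | no ¬ab = ascent-step x ax ◅ conj ◅ ε , conj ◅ descent-step y (¬ascent⇒descent y y-inj ¬ay) ◅ ε
    where
    y = x · transp i j
    y-inj = IsPerm-·transp x i j x-inj
    conj = conj-step x i<j (ℓ-increase⇒ascent x x-inj i<j ℓx<ℓy) ¬ab

  lower-upper-mono : ∀ {x y} → IsPerm x → x ≤Bruhat y → (lower x ≤Bruhat lower y) × (upper x ≤Bruhat upper y)
  lower-upper-mono x-inj ε = ε , ε
  lower-upper-mono {x} x-inj (step@(i , j , _ , refl , _) ◅ steps)
    with lower-upper-mono-step x x-inj step | lower-upper-mono (IsPerm-·transp x i j x-inj) steps
  ... | lower≤₁ , upper≤₁ | lower≤₂ , upper≤₂ = lower≤₁ ◅◅ lower≤₂ , upper≤₁ ◅◅ upper≤₂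

  lower-ascent : ∀ w → Ascent w → lower w ≡ w
  lower-ascent w asc with ascent? w
  ... | yes _ = refl
  ... | no ¬asc = ⊥-elim (¬asc asc)

  lower-¬ascent : ∀ w → ¬ Ascent w → lower w ≡ w · s r
  lower-¬ascent w ¬asc with ascent? w
  ... | yes asc = ⊥-elim (¬asc asc)
  ... | no _ = refl

  upper-ascent : ∀ w → Ascent w → upper w ≡ w · s r
  upper-ascent w asc with ascent? w
  ... | yes _ = refl
  ... | no ¬asc = ⊥-elim (¬asc asc)

  ≤Bruhat-lower-descent : ∀ {x y} → IsPerm x → x ≤Bruhat y → Descent y → lower x ≤Bruhat (y · s r)
  ≤Bruhat-lower-descent {x} {y} x-inj x≤y desc =
    subst (lower x ≤Bruhat_) (lower-¬ascent y (Fin.<-asym desc)) (proj₁ (lower-upper-mono x-inj x≤y))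

  ≤Bruhat-·s-ascent : ∀ {x y} → IsPerm x → x ≤Bruhat y → Ascent y → (x · s r) ≤Bruhat (y · s r)
  ≤Bruhat-·s-ascent {x} {y} x-inj x≤y ay with ascent? x
  ... | yes ax = subst₂ _≤Bruhat_ (upper-ascent x ax) (upper-ascent y ay) (proj₂ (lower-upper-mono x-inj x≤y))
  ... | no ¬ax = subst₂ _≤Bruhat_ (lower-¬ascent x ¬ax) (lower-ascent y ay) (proj₁ (lower-upper-mono x-inj x≤y))
                   ◅◅ ascent-step y ay ◅ ε

  minPerm-·s⁻¹ : ∀ {γ w} → IsMinPerm (γ · s r) w → lookup γ a ≢ lookup γ b → IsMinPerm γ (w · s r)
  minPerm-·s⁻¹ {γ} {w} m γa≢γb = subst (λ δ → IsMinPerm δ (w · s r)) (·s-involutive γ)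
    (minPerm-·s m (λ γ′a≡γ′b → γa≢γb (sym (trans (sym (lookup-·s-a γ)) (trans γ′a≡γ′b (lookup-·s-b γ))))))

  module _ {α : Composition (suc m)} (α-asc : lookup α a < lookup α b) where

    minPerm-·s-ascent : ∀ {w} → IsMinPerm (α · s r) w → Ascent w
    minPerm-·s-ascent m′ = minPerm-ascent m′ (subst₂ _<_ (sym (lookup-·s-b α)) (sym (lookup-·s-a α)) α-asc)

    V-·s⇒V : ∀ {β} → V (α · s r) β → V α β
    V-·s⇒V (λβ≡λα′ , wβ , w′ , mβ , m′ , wβ≤w′) =
      trans λβ≡λα′ (partitionOf-·s α r) , wβ , w′ · s r , mβ , minPerm-·s⁻¹ m′ (ℕ.<⇒≢ α-asc) ,
      wβ≤w′ ◅◅ ascent-step w′ (minPerm-·s-ascent m′) ◅ ε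

    V-·s⇒V-·s : ∀ {v} → V (α · s r) v → V α (v · s r)
    V-·s⇒V-·s {v} V′v@(λv≡λα′ , wv , w′ , mv , m′ , wv≤w′) with lookup v a ℕ.≟ lookup v b
    ... | yes va≡vb = subst (V α) (sym (·s-fixes-equal v va≡vb)) (V-·s⇒V V′v)
    ... | no va≢vb =
      trans (partitionOf-·s v r) (trans λv≡λα′ (partitionOf-·s α r)) , wv · s r , w′ · s r ,
      minPerm-·s mv va≢vb , minPerm-·s⁻¹ m′ (ℕ.<⇒≢ α-asc) ,
      ≤Bruhat-·s-ascent (proj₁ mv) wv≤w′ (minPerm-·s-ascent m′)

    V⇒V-·s-or-·s : ∀ {β} → V α β → V (α · s r) β ⊎ Σ (Composition (suc m)) (λ v → V (α · s r) v × (β ≡ v · s r))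
    V⇒V-·s-or-·s {β} (λβ≡λα , wβ , wα , mβ , mα , wβ≤wα) = by-ascent (ascent? wβ)
      where
      λβ≡λα′ : partitionOf β ≡ partitionOf (α · s r)
      λβ≡λα′ = trans λβ≡λα (sym (partitionOf-·s α r))
      mα′ : IsMinPerm (α · s r) (wα · s r)
      mα′ = minPerm-·s mα (ℕ.<⇒≢ α-asc)
      below : lower wβ ≤Bruhat (wα · s r)
      below = ≤Bruhat-lower-descent (proj₁ mβ) wβ≤wα (minPerm-descent mα α-asc)
      by-ascent : Dec (Ascent wβ) → V (α · s r) β ⊎ Σ (Composition (suc m)) (λ v → V (α · s r) v × (β ≡ v · s r))
      by-ascent (yes asc) =
        inj₁ (λβ≡λα′ , wβ , wα · s r , mβ , mα′ , subst (_≤Bruhat (wα · s r)) (lower-ascent wβ asc) below)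
      by-ascent (no ¬asc) =
        inj₂ (β · s r , (trans (partitionOf-·s β r) λβ≡λα′ , wβ · s r , wα · s r ,
                         minPerm-·s mβ (¬asc ∘ minPerm-ascent-of-equal mβ) , mα′ ,
                         subst (_≤Bruhat (wα · s r)) (lower-¬ascent wβ ¬asc) below) ,
              sym (·s-involutive β))

open AdjacentTransposition using (V-·s⇒V; V-·s⇒V-·s; V⇒V-·s-or-·s)

proposition4p3 : (m : ℕ) (α : Composition (suc m)) (r : Fin m) →
    lookup α (inject₁ r) < lookup α (Fin.suc r) →
    (β : Composition (suc m)) →
      V α β ⇔ (V (α · s r) β ⊎ Σ (Composition (suc m)) (λ v → V (α · s r) v × (β ≡ v · s r)))
proposition4p3 m α r α-asc β = mk⇔ (V⇒V-·s-or-·s r α-asc) [ V-·s⇒V r α-asc , from-·s ]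
  where
  from-·s : Σ (Composition (suc m)) (λ v → V (α · s r) v × (β ≡ v · s r)) → V α β
  from-·s (v , V′v , refl) = V-·s⇒V-·s r α-asc V′v
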